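{- Let $g$ be a convex geometry on a finite set $I$ and $F=(F_1,\dots,F_k)$ a set composition of $I$, with $A_i=F_1\cup\dots\cup F_i$ ($A_0=\emptyset$). The following are equivalent: (1) $F\in\mathrm{int}(V_g)$; (2) $A_i$ is convex for each $0\le i\le k$ and $g_{A_i:A_{i+1}}$ is discrete for all $0\le i\le k-1$.
   Context: A convex geometry on finite $I$ is $g:2^I\to2^I$ with $A\subseteq g(A)$, $g(g(A))=g(A)$, monotone, $g(\emptyset)=\emptyset$, and anti-exchange (if $a\ne b$, $a,b\notin g(A)$, $a\in g(A\cup\{b\})$ then $b\notin g(A\cup\{a\})$). Convex sets: $g(K)=K$. For convex $A\subseteq B$, the minor $g_{A:B}$ on $B\setminus A$ is $g_{A:B}(X)=g(A\cup X)\cap(B\setminus A)$; discrete means $g_{A:B}(X)=X$ for all $X\subseteq B\setminus A$. Set compositions of $I$ (ordered sequences of nonempty disjoint blocks with union $I$) are the faces of the braid arrangement of $I$; $F\le G$ if $G$ is obtained from $F$ by splitting each block into an ordered sequence of nonempty sub-blocks. $V_g$ is the set of set compositions all of whose initial unions are convex. The star of $F$ is $\{G: F\le G\}$, and $\mathrm{int}(V_g)=\{F\in V_g:\ \mathrm{star}(F)\subseteq V_g\}$. -}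

module Defs where

open import Data.Nat using (ℕ; suc; _≤_; _<_)
open import Data.Fin using (Fin)
open import Data.Fin.Subset using (Subset; _∈_; _∉_; _⊆_; _∪_; _∩_; _─_; ⊥; ⊤; ⋃; ⁅_⁆; Nonempty)
open import Data.List using (List; []; _∷_; _++_; length; take)
open import Data.List.Relation.Unary.All using (All)
open import Data.List.Relation.Unary.AllPairs using (AllPairs)
open import Data.Product using (_×_)
open import Relation.Binary.PropositionalEquality using (_≡_)
open import Relation.Nullary using (¬_)

record ConvexGeometry (n : ℕ) : Set where
  field
    g            : Subset n → Subset n
    extensive    : ∀ A → A ⊆ g A
    idempotent   : ∀ A → g (g A) ≡ g A
    monotone     : ∀ A B → A ⊆ B → g A ⊆ g B
    g-empty      : g ⊥ ≡ ⊥
    antiExchange : ∀ A (a b : Fin n) → ¬ (a ≡ b) → a ∉ g A → b ∉ g A →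
                   a ∈ g (A ∪ ⁅ b ⁆) → b ∉ g (A ∪ ⁅ a ⁆)

module _ {n : ℕ} (cg : ConvexGeometry n) where
  open ConvexGeometry cg

  Convex : Subset n → Set
  Convex K = g K ≡ K

  minor : Subset n → Subset n → Subset n → Subset n
  minor A B X = g (A ∪ X) ∩ (B ─ A)

  Discrete : Subset n → Subset n → Set
  Discrete A B = ∀ X → X ⊆ (B ─ A) → minor A B X ≡ X

IsSetCompOf : ∀ {n} → Subset n → List (Subset n) → Set
IsSetCompOf S F = All Nonempty F × AllPairs (λ X Y → X ∩ Y ≡ ⊥) F × ⋃ F ≡ S

IsSetComp : ∀ {n} → List (Subset n) → Set
IsSetComp F = IsSetCompOf ⊤ F

data _≤F_ {n : ℕ} : List (Subset n) → List (Subset n) → Set where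
  []≤  : [] ≤F []
  ∷≤   : ∀ {B F H G} → IsSetCompOf B H → F ≤F G → (B ∷ F) ≤F (H ++ G)

initUnion : ∀ {n} → List (Subset n) → ℕ → Subset n
initUnion F i = ⋃ (take i F)

module _ {n : ℕ} (cg : ConvexGeometry n) where

  InV : List (Subset n) → Set
  InV F = IsSetComp F × (∀ i → i ≤ length F → Convex cg (initUnion F i))

  InStar : List (Subset n) → List (Subset n) → Set
  InStar F G = IsSetComp G × F ≤F G

  InInt : List (Subset n) → Set
  InInt F = InV F × (∀ G → InStar F G → InV G)

{-# OPTIONS --safe #-}
-- For convex P ⊆ Q the minor g_{P:Q} is discrete exactly when P ∪ X is convex for
-- every X ⊆ Q ∖ P. Each initial union of a refinement G of F has the form A_i ∪ X
-- with X ⊆ F_{i+1}, so discrete minors make every initial union of G convex.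
-- Conversely, for X ⊆ F_{i+1} the set A_i ∪ X is an initial union either of F
-- itself (X = ∅ or X = F_{i+1}) or of the refinement splitting F_{i+1} into X and
-- F_{i+1} ∖ X, so it is convex whenever F lies in the interior of V_g.
module Submission where

open import Defs
open import Data.Nat using (ℕ; zero; suc; _≤_; _<_; z≤n; s≤s)
open import Data.Fin using (Fin)
open import Data.Vec.Base using (_∷_; there)
open import Data.Fin.Subset
  using (Subset; _∈_; _∉_; _⊆_; _∪_; _∩_; _─_; ⋃; Nonempty; Empty; inside; outside)
  renaming (⊥ to ∅)
open import Data.Fin.Subset.Properties
  using ( _∈?_; nonempty?; Empty-unique; ∉⊥; ⊥⊆; ⊆-antisym; ⊆-reflexive; ⊆-trans
        ; x∈p∩q⁺; x∈p∩q⁻; x∈p∪q⁺; x∈p∪q⁻; p⊆p∪q; q⊆p∪q; p─q⊆p; x∈p∧x∉q⇒x∈p─q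
        ; ∪-assoc; ∪-identityˡ; ∪-identityʳ; ∩-zeroʳ; ∩-distribˡ-∪ )
open import Data.List using (List; []; _∷_; _++_; [_]; length)
open import Data.List.Relation.Unary.All as All using (All; []; _∷_)
import Data.List.Relation.Unary.All.Properties as All
open import Data.List.Relation.Unary.AllPairs using ([]; _∷_)
import Data.List.Relation.Unary.AllPairs.Properties as AllPairs
open import Data.Product using (_×_; _,_; proj₁; proj₂)
open import Data.Sum using (inj₁; inj₂)
open import Data.Unit using (tt) renaming (⊤ to Unit)
open import Function.Bundles using (_⇔_; mk⇔; Equivalence)
open import Relation.Binary.PropositionalEquality
  using (_≡_; refl; sym; trans; cong; cong₂; subst; subst₂; module ≡-Reasoning)
open import Relation.Nullary using (yes; no; contradiction)

open Equivalence using (to; from)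

x∈p─q⇒x∉q : ∀ {n} {p q : Subset n} {x} → x ∈ p ─ q → x ∉ q
x∈p─q⇒x∉q {p = _ ∷ _} {inside  ∷ _} {Fin.zero}  ()
x∈p─q⇒x∉q {p = _ ∷ _} {outside ∷ _} {Fin.zero}  _         ()
x∈p─q⇒x∉q {p = _ ∷ _} {_ ∷ _}       {Fin.suc _} (there m) (there m′) = x∈p─q⇒x∉q m m′

module _ {n : ℕ} where

  x∈p∪q∧x∉p⇒x∈q : ∀ {p q : Subset n} {x} → x ∈ p ∪ q → x ∉ p → x ∈ q
  x∈p∪q∧x∉p⇒x∈q {p} {q} x∈p∪q x∉p with x∈p∪q⁻ p q x∈p∪q
  ... | inj₁ x∈p = contradiction x∈p x∉p
  ... | inj₂ x∈q = x∈q

  [p∪q]─p⊆q : ∀ (p q : Subset n) → (p ∪ q) ─ p ⊆ q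
  [p∪q]─p⊆q p q x∈[p∪q]─p = x∈p∪q∧x∉p⇒x∈q (p─q⊆p (p ∪ q) p x∈[p∪q]─p) (x∈p─q⇒x∉q x∈[p∪q]─p)

  ∪-lub : ∀ {p q r : Subset n} → p ⊆ r → q ⊆ r → p ∪ q ⊆ r
  ∪-lub {p} {q} p⊆r q⊆r x∈p∪q with x∈p∪q⁻ p q x∈p∪q
  ... | inj₁ x∈p = p⊆r x∈p
  ... | inj₂ x∈q = q⊆r x∈q

  ∪-monoʳ-⊆ : ∀ (p : Subset n) {q r} → q ⊆ r → p ∪ q ⊆ p ∪ r
  ∪-monoʳ-⊆ p {r = r} q⊆r = ∪-lub (p⊆p∪q r) (λ x∈q → q⊆p∪q p r (q⊆r x∈q))

  ─-monoˡ-⊆ : ∀ {p q : Subset n} (r : Subset n) → p ⊆ q → p ─ r ⊆ q ─ r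
  ─-monoˡ-⊆ {p} r p⊆q x∈p─r = x∈p∧x∉q⇒x∈p─q (p⊆q (p─q⊆p p r x∈p─r)) (x∈p─q⇒x∉q x∈p─r)

  p∪q⊆p∪[q─p] : ∀ (p q : Subset n) → p ∪ q ⊆ p ∪ (q ─ p)
  p∪q⊆p∪[q─p] p q = ∪-lub (p⊆p∪q (q ─ p)) q⊆p∪[q─p]
    where
      q⊆p∪[q─p] : q ⊆ p ∪ (q ─ p)
      q⊆p∪[q─p] {x} x∈q with x ∈? p
      ... | yes x∈p = x∈p∪q⁺ (inj₁ x∈p)
      ... | no  x∉p = x∈p∪q⁺ (inj₂ (x∈p∧x∉q⇒x∈p─q x∈q x∉p))

  p⊆q⇒p∪[q─p]≡q : ∀ {p q : Subset n} → p ⊆ q → p ∪ (q ─ p) ≡ q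
  p⊆q⇒p∪[q─p]≡q {p} {q} p⊆q =
    ⊆-antisym (∪-lub p⊆q (p─q⊆p q p)) (λ x∈q → p∪q⊆p∪[q─p] p q (q⊆p∪q p q x∈q))

  ─-empty⇒≡ : ∀ {p q : Subset n} → p ⊆ q → Empty (q ─ p) → p ≡ q
  ─-empty⇒≡ {p} {q} p⊆q q─p-empty = ⊆-antisym p⊆q q⊆p
    where
      q⊆p : q ⊆ p
      q⊆p {x} x∈q with x ∈? p
      ... | yes x∈p = x∈p
      ... | no  x∉p = contradiction (x , x∈p∧x∉q⇒x∈p─q x∈q x∉p) q─p-empty

  ⋃-++ : ∀ (ps qs : List (Subset n)) → ⋃ (ps ++ qs) ≡ ⋃ ps ∪ ⋃ qs
  ⋃-++ []       qs = sym (∪-identityˡ (⋃ qs))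
  ⋃-++ (p ∷ ps) qs = trans (cong (p ∪_) (⋃-++ ps qs)) (sym (∪-assoc p (⋃ ps) (⋃ qs)))

  ⊆-⋃ : ∀ (ps : List (Subset n)) → All (_⊆ ⋃ ps) ps
  ⊆-⋃ []       = []
  ⊆-⋃ (p ∷ ps) = p⊆p∪q (⋃ ps) ∷ All.map (λ q⊆⋃ps {x} x∈q → q⊆p∪q p (⋃ ps) (q⊆⋃ps x∈q)) (⊆-⋃ ps)

  Disjoint : Subset n → Subset n → Set
  Disjoint p q = p ∩ q ≡ ∅

  disjoint⁺ : ∀ {p q : Subset n} → (∀ {x} → x ∈ p → x ∉ q) → Disjoint p q
  disjoint⁺ {p} {q} apart =
    Empty-unique λ (x , x∈p∩q) → let (x∈p , x∈q) = x∈p∩q⁻ p q x∈p∩q in apart x∈p x∈q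

  disjoint⁻ : ∀ {p q : Subset n} {x} → Disjoint p q → x ∈ p → x ∉ q
  disjoint⁻ p∩q≡∅ x∈p x∈q = ∉⊥ (subst (_ ∈_) p∩q≡∅ (x∈p∩q⁺ (x∈p , x∈q)))

  disjoint-mono : ∀ {p p′ q q′ : Subset n} → p ⊆ p′ → q ⊆ q′ → Disjoint p′ q′ → Disjoint p q
  disjoint-mono p⊆p′ q⊆q′ disj = disjoint⁺ λ x∈p x∈q → disjoint⁻ disj (p⊆p′ x∈p) (q⊆q′ x∈q)

  disjoint-⋃ : ∀ {p : Subset n} qs → All (Disjoint p) qs → Disjoint p (⋃ qs)
  disjoint-⋃ {p} []       []         = ∩-zeroʳ p
  disjoint-⋃ {p} (q ∷ qs) (pq ∷ pqs) = begin
    p ∩ (q ∪ ⋃ qs)        ≡⟨ ∩-distribˡ-∪ p q (⋃ qs) ⟩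
    (p ∩ q) ∪ (p ∩ ⋃ qs)  ≡⟨ cong₂ _∪_ pq (disjoint-⋃ qs pqs) ⟩
    ∅ ∪ ∅                 ≡⟨ ∪-identityˡ ∅ ⟩
    ∅                     ∎
    where open ≡-Reasoning

  singleton-setComp : ∀ {B : Subset n} → Nonempty B → IsSetCompOf B [ B ]
  singleton-setComp {B} B≢∅ = B≢∅ ∷ [] , [] ∷ [] , ∪-identityʳ B

  split-setComp : ∀ {X B : Subset n} → X ⊆ B → Nonempty X → Nonempty (B ─ X) →
                  IsSetCompOf B (X ∷ (B ─ X) ∷ [])
  split-setComp {X} {B} X⊆B X≢∅ B─X≢∅ =
    X≢∅ ∷ B─X≢∅ ∷ [] ,
    (disjoint⁺ (λ x∈X x∈B─X → x∈p─q⇒x∉q x∈B─X x∈X) ∷ []) ∷ [] ∷ [] ,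
    trans (cong (X ∪_) (∪-identityʳ (B ─ X))) (p⊆q⇒p∪[q─p]≡q X⊆B)

  ≤F-refl : ∀ {F : List (Subset n)} → All Nonempty F → F ≤F F
  ≤F-refl []          = []≤
  ≤F-refl (B≢∅ ∷ F≢∅) = ∷≤ (singleton-setComp B≢∅) (≤F-refl F≢∅)

  ≤F-preserves-setComp : ∀ {S} {F G : List (Subset n)} → IsSetCompOf S F → F ≤F G → IsSetCompOf S G
  ≤F-preserves-setComp F-comp []≤ = F-comp
  ≤F-preserves-setComp {S} (_ ∷ F≢∅ , B-disj ∷ F-disj , B∪⋃F≡S)
                           (∷≤ {B} {F} {H} {G} (H≢∅ , H-disj , ⋃H≡B) F≤G)
    with ≤F-preserves-setComp (F≢∅ , F-disj , refl) F≤G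
  ... | G≢∅ , G-disj , ⋃G≡⋃F =
    All.++⁺ H≢∅ G≢∅ , AllPairs.++⁺ H-disj G-disj H-G-disj , ⋃[H++G]≡S
    where
      H-G-disj : All (λ h → All (Disjoint h) G) H
      H-G-disj = All.map {P = _⊆ ⋃ H} (λ h⊆⋃H → All.map {P = _⊆ ⋃ G} (λ g⊆⋃G →
          disjoint-mono (⊆-trans h⊆⋃H (⊆-reflexive ⋃H≡B))
                        (⊆-trans g⊆⋃G (⊆-reflexive ⋃G≡⋃F))
                        (disjoint-⋃ F B-disj))
        (⊆-⋃ G)) (⊆-⋃ H)
      ⋃[H++G]≡S : ⋃ (H ++ G) ≡ S
      ⋃[H++G]≡S = begin
        ⋃ (H ++ G)   ≡⟨ ⋃-++ H G ⟩
        ⋃ H ∪ ⋃ G    ≡⟨ cong₂ _∪_ ⋃H≡B ⋃G≡⋃F ⟩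
        B ∪ ⋃ F      ≡⟨ B∪⋃F≡S ⟩
        S            ∎
        where open ≡-Reasoning

  AllInitUnions : (Subset n → Set) → Subset n → List (Subset n) → Set
  AllInitUnions R P []      = R P
  AllInitUnions R P (B ∷ F) = R P × AllInitUnions R (P ∪ B) F

  AllInitSteps : (Subset n → Subset n → Set) → Subset n → List (Subset n) → Set
  AllInitSteps S P []      = Unit
  AllInitSteps S P (B ∷ F) = S P (P ∪ B) × AllInitSteps S (P ∪ B) F

  AllInitUnions-head : ∀ {R P} F → AllInitUnions R P F → R P
  AllInitUnions-head []      RP       = RP
  AllInitUnions-head (_ ∷ _) (RP , _) = RP

  AllInitUnions-++ : ∀ {R P} H {G} → (∀ X → X ⊆ ⋃ H → R (P ∪ X)) →
                     AllInitUnions R (P ∪ ⋃ H) G → AllInitUnions R P (H ++ G)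
  AllInitUnions-++ {R} {P} [] {G} _ RG = subst (λ Q → AllInitUnions R Q G) (∪-identityʳ P) RG
  AllInitUnions-++ {R} {P} (h ∷ H) {G} R[P∪⊆⋃] RG =
    subst R (∪-identityʳ P) (R[P∪⊆⋃] ∅ ⊥⊆) ,
    AllInitUnions-++ H
      (λ X X⊆⋃H → subst R (sym (∪-assoc P h X)) (R[P∪⊆⋃] (h ∪ X) (∪-monoʳ-⊆ h X⊆⋃H)))
      (subst (λ Q → AllInitUnions R Q G) (sym (∪-assoc P h (⋃ H))) RG)

  AllInitUnions-∅⇔ : ∀ R F → AllInitUnions R ∅ F ⇔ (∀ i → i ≤ length F → R (initUnion F i))
  AllInitUnions-∅⇔ R F = mk⇔
    (λ RF i i≤F → subst R (∪-identityˡ _) (forward ∅ F RF i i≤F))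
    (λ RF → backward ∅ F (λ i i≤F → subst R (sym (∪-identityˡ _)) (RF i i≤F)))
    where
      forward : ∀ P F → AllInitUnions R P F → ∀ i → i ≤ length F → R (P ∪ initUnion F i)
      forward P F       RF      zero    _          = subst R (sym (∪-identityʳ P)) (AllInitUnions-head F RF)
      forward P (B ∷ F) (_ , RF) (suc i) (s≤s i≤F) = subst R (∪-assoc P B _) (forward (P ∪ B) F RF i i≤F)
      backward : ∀ P F → (∀ i → i ≤ length F → R (P ∪ initUnion F i)) → AllInitUnions R P F
      backward P []      RF = subst R (∪-identityʳ P) (RF 0 z≤n)
      backward P (B ∷ F) RF = subst R (∪-identityʳ P) (RF 0 z≤n) ,
        backward (P ∪ B) F (λ i i≤F → subst R (sym (∪-assoc P B _)) (RF (suc i) (s≤s i≤F)))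

  AllInitSteps-∅⇔ : ∀ S F → AllInitSteps S ∅ F ⇔
                    (∀ i → i < length F → S (initUnion F i) (initUnion F (suc i)))
  AllInitSteps-∅⇔ S F = mk⇔
    (λ SF i i<F → subst₂ S (∪-identityˡ _) (∪-identityˡ _) (forward ∅ F SF i i<F))
    (λ SF → backward ∅ F (λ i i<F → subst₂ S (sym (∪-identityˡ _)) (sym (∪-identityˡ _)) (SF i i<F)))
    where
      forward : ∀ P F → AllInitSteps S P F →
                ∀ i → i < length F → S (P ∪ initUnion F i) (P ∪ initUnion F (suc i))
      forward P (B ∷ F) (SB , _) zero _ =
        subst₂ S (sym (∪-identityʳ P)) (cong (P ∪_) (sym (∪-identityʳ B))) SB
      forward P (B ∷ F) (_ , SF) (suc i) (s≤s i<F) =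
        subst₂ S (∪-assoc P B _) (∪-assoc P B _) (forward (P ∪ B) F SF i i<F)
      backward : ∀ P F → (∀ i → i < length F → S (P ∪ initUnion F i) (P ∪ initUnion F (suc i))) →
                 AllInitSteps S P F
      backward P []      _  = tt
      backward P (B ∷ F) SF =
        subst₂ S (∪-identityʳ P) (cong (P ∪_) (∪-identityʳ B)) (SF 0 (s≤s z≤n)) ,
        backward (P ∪ B) F (λ i i<F → subst₂ S (sym (∪-assoc P B _)) (sym (∪-assoc P B _)) (SF (suc i) (s≤s i<F)))

module _ {n : ℕ} (cg : ConvexGeometry n) where
  open ConvexGeometry cg

  discrete⇒convex-∪ : ∀ {P Q X} → Convex cg Q → P ⊆ Q → Discrete cg P Q → X ⊆ Q → Convex cg (P ∪ X)
  discrete⇒convex-∪ {P} {Q} {X} Q-convex P⊆Q discrete X⊆Q = ⊆-antisym g[P∪X]⊆P∪X (extensive (P ∪ X))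
    where
      g[P∪X]⊆P∪X : g (P ∪ X) ⊆ P ∪ X
      g[P∪X]⊆P∪X {x} x∈g with x ∈? P
      ... | yes x∈P = x∈p∪q⁺ (inj₁ x∈P)
      ... | no  x∉P = x∈p∪q⁺ (inj₂ (p─q⊆p X P x∈X─P))
        where
          x∈Q─P : x ∈ Q ─ P
          x∈Q─P = x∈p∧x∉q⇒x∈p─q (subst (x ∈_) Q-convex (monotone (P ∪ X) Q (∪-lub P⊆Q X⊆Q) x∈g)) x∉P
          x∈X─P : x ∈ X ─ P
          x∈X─P = subst (x ∈_) (discrete (X ─ P) (─-monoˡ-⊆ P X⊆Q))
                    (x∈p∩q⁺ (monotone (P ∪ X) (P ∪ (X ─ P)) (p∪q⊆p∪[q─p] P X) x∈g , x∈Q─P))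

  convex-∪⇒discrete : ∀ {P Q} → (∀ X → X ⊆ Q ─ P → Convex cg (P ∪ X)) → Discrete cg P Q
  convex-∪⇒discrete {P} {Q} P∪X-convex X X⊆Q─P = ⊆-antisym minor⊆X X⊆minor
    where
      minor⊆X : g (P ∪ X) ∩ (Q ─ P) ⊆ X
      minor⊆X x∈minor =
        let (x∈g , x∈Q─P) = x∈p∩q⁻ (g (P ∪ X)) (Q ─ P) x∈minor
        in x∈p∪q∧x∉p⇒x∈q (subst (_ ∈_) (P∪X-convex X X⊆Q─P) x∈g) (x∈p─q⇒x∉q x∈Q─P)
      X⊆minor : X ⊆ g (P ∪ X) ∩ (Q ─ P)
      X⊆minor x∈X = x∈p∩q⁺ (extensive (P ∪ X) (q⊆p∪q P X x∈X) , X⊆Q─P x∈X)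

  refinement-convex : ∀ {P F G} → AllInitUnions (Convex cg) P F → AllInitSteps (Discrete cg) P F →
                      F ≤F G → AllInitUnions (Convex cg) P G
  refinement-convex P-convex _ []≤ = P-convex
  refinement-convex {P} (_ , convex) (discrete , discretes) (∷≤ {B} {F} {H} {G} (_ , _ , ⋃H≡B) F≤G) =
    AllInitUnions-++ H P∪X-convex
      (subst (λ Y → AllInitUnions (Convex cg) (P ∪ Y) G) (sym ⋃H≡B) (refinement-convex convex discretes F≤G))
    where
      P∪X-convex : ∀ X → X ⊆ ⋃ H → Convex cg (P ∪ X)
      P∪X-convex X X⊆⋃H = discrete⇒convex-∪ (AllInitUnions-head F convex) (p⊆p∪q B) discrete
                            (λ x∈X → q⊆p∪q P B (subst (_ ∈_) ⋃H≡B (X⊆⋃H x∈X)))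

  interior⇒discrete : ∀ {P F} → All Nonempty F → (∀ G → F ≤F G → AllInitUnions (Convex cg) P G) →
                      AllInitSteps (Discrete cg) P F
  interior⇒discrete [] _ = tt
  interior⇒discrete {P} {B ∷ F} (B≢∅ ∷ F≢∅) refinements-convex =
    convex-∪⇒discrete P∪X-convex ,
    interior⇒discrete F≢∅ (λ G F≤G → proj₂ (refinements-convex (B ∷ G) (∷≤ (singleton-setComp B≢∅) F≤G)))
    where
      BF-convex : Convex cg P × AllInitUnions (Convex cg) (P ∪ B) F
      BF-convex = refinements-convex (B ∷ F) (≤F-refl (B≢∅ ∷ F≢∅))
      P∪X-convex : ∀ X → X ⊆ (P ∪ B) ─ P → Convex cg (P ∪ X)
      P∪X-convex X X⊆[P∪B]─P with X⊆B ← ⊆-trans X⊆[P∪B]─P ([p∪q]─p⊆q P B) | nonempty? X | nonempty? (B ─ X)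
      ... | no X-empty | _ =
        subst (Convex cg) (sym (trans (cong (P ∪_) (Empty-unique X-empty)) (∪-identityʳ P))) (proj₁ BF-convex)
      ... | yes _ | no B─X-empty =
        subst (λ Y → Convex cg (P ∪ Y)) (sym (─-empty⇒≡ X⊆B B─X-empty)) (AllInitUnions-head F (proj₂ BF-convex))
      ... | yes X≢∅ | yes B─X≢∅ =
        proj₁ (proj₂ (refinements-convex (X ∷ (B ─ X) ∷ F) (∷≤ (split-setComp X⊆B X≢∅ B─X≢∅) (≤F-refl F≢∅))))

mainTheorem12 : (n : ℕ) (cg : ConvexGeometry n) (F : List (Subset n)) → IsSetComp F →
    InInt cg F ⇔ ((∀ i → i ≤ length F → Convex cg (initUnion F i))
                 × (∀ i → i < length F → Discrete cg (initUnion F i) (initUnion F (suc i))))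
mainTheorem12 n cg F F-comp = mk⇔
  (λ ((_ , convex) , star) → convex ,
    AllInitSteps-∅⇔ _ F .to (interior⇒discrete cg (proj₁ F-comp) λ G F≤G →
      AllInitUnions-∅⇔ _ G .from (proj₂ (star G (≤F-preserves-setComp F-comp F≤G , F≤G)))))
  (λ (convex , discrete) → (F-comp , convex) , λ G (G-comp , F≤G) → G-comp ,
    AllInitUnions-∅⇔ _ G .to
      (refinement-convex cg (AllInitUnions-∅⇔ _ F .from convex) (AllInitSteps-∅⇔ _ F .from discrete) F≤G))
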